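{- There is no $*$-term $P$ such that $se(P)=X[\triangle\mapsto Y]$ for some $X\in\mathcal T_{A,\triangle}$ and $Y\in\mathcal T_A$ with $X\neq\triangle$, $X$ containing $\triangle$, and $X$ containing neither $\mathsf T$ nor $\mathsf F$.
   Context: Closed terms over constants $\mathsf T,\mathsf F$, atoms $a\in A$ ($A$ non-empty), unary $\neg$ and binary $\wedge,\vee$. Grammar (with $a\in A$): $P^{\mathsf T}::=\mathsf T\mid (a\wedge P^{\mathsf T})\vee P^{\mathsf T}$; $P^{\mathsf F}::=\mathsf F\mid (a\vee P^{\mathsf F})\wedge P^{\mathsf F}$; $\ell$-terms $P^\ell::=(a\wedge P^{\mathsf T})\vee P^{\mathsf F}\mid(\neg a\wedge P^{\mathsf T})\vee P^{\mathsf F}$; $*$-terms $P^*::=P^c\mid P^d$, $P^c::=P^\ell\mid P^*\wedge P^d$, $P^d::=P^\ell\mid P^*\vee P^c$. $\mathcal T_A$: least set containing $\mathsf T,\mathsf F$ and $X\trianglelefteq a\trianglerighteq Y$ for $X,Y\in\mathcal T_A$, $a\in A$; $\mathcal T_{A,\triangle}$ likewise with leaves in $\{\mathsf T,\mathsf F,\triangle\}$. Leaf replacement $X[\ell_1\mapsto Y_1,\dots]$ replaces every leaf $\ell_i$ of $X$ by $Y_i$. $se(\mathsf T)=\mathsf T$, $se(\mathsf F)=\mathsf F$, $se(a)=\mathsf T\trianglelefteq a\trianglerighteq\mathsf F$, $se(\neg P)=se(P)[\mathsf T\mapsto\mathsf F,\mathsf F\mapsto\mathsf T]$, $se(P\wedge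 Q)=se(P)[\mathsf T\mapsto se(Q)]$, $se(P\vee Q)=se(P)[\mathsf F\mapsto se(Q)]$. -}

module Defs where

open import Relation.Binary.PropositionalEquality using (_≡_)

data Term (A : Set) : Set where
  ‵T ‵F : Term A
  atom  : A → Term A
  ‵¬_   : Term A → Term A
  _‵∧_  : Term A → Term A → Term A
  _‵∨_  : Term A → Term A → Term A

data IsPT {A : Set} : Term A → Set where
  pT   : IsPT ‵T
  pTst : ∀ {a P Q} → IsPT P → IsPT Q → IsPT ((atom a ‵∧ P) ‵∨ Q)

data IsPF {A : Set} : Term A → Set where
  pF   : IsPF ‵F
  pFst : ∀ {a P Q} → IsPF P → IsPF Q → IsPF ((atom a ‵∨ P) ‵∧ Q)

data IsLit {A : Set} : Term A → Set where
  pos : ∀ {a P Q} → IsPT P → IsPF Q → IsLit ((atom a ‵∧ P) ‵∨ Q)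
  neg : ∀ {a P Q} → IsPT P → IsPF Q → IsLit (((‵¬ atom a) ‵∧ P) ‵∨ Q)

data IsStar {A : Set} : Term A → Set
data IsC {A : Set} : Term A → Set
data IsD {A : Set} : Term A → Set

data IsStar {A} where
  starC : ∀ {P} → IsC P → IsStar P
  starD : ∀ {P} → IsD P → IsStar P

data IsC {A} where
  cLit : ∀ {P} → IsLit P → IsC P
  cAnd : ∀ {P Q} → IsStar P → IsD Q → IsC (P ‵∧ Q)

data IsD {A} where
  dLit : ∀ {P} → IsLit P → IsD P
  dOr  : ∀ {P Q} → IsStar P → IsC Q → IsD (P ‵∨ Q)

data Leaf : Set where
  lT lF l△ : Leaf

data Tree (L : Set) (A : Set) : Set where
  leaf : L → Tree L A
  node : Tree L A → A → Tree L A → Tree L A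

TreeΔ : Set → Set
TreeΔ A = Tree Leaf A

data LeafTF : Set where
  tT tF : LeafTF

TreeA : Set → Set
TreeA A = Tree LeafTF A

replace : {L M A : Set} → (L → Tree M A) → Tree L A → Tree M A
replace f (leaf l)     = f l
replace f (node X a Y) = node (replace f X) a (replace f Y)

embedTF : LeafTF → Leaf
embedTF tT = lT
embedTF tF = lF

-- X[△ ↦ Y] for X ∈ T_{A,△}, Y ∈ T_A (result in T_A; only meaningful when X has no T/F
-- leaves, but defined generally: T ↦ T, F ↦ F)
subst△ : {A : Set} → TreeΔ A → TreeA A → TreeA A
subst△ X Y = replace f X
  where
  f : Leaf → Tree LeafTF _
  f lT = leaf tT
  f lF = leaf tF
  f l△ = Y

se : {A : Set} → Term A → TreeA A
se ‵T        = leaf tT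
se ‵F        = leaf tF
se (atom a)  = node (leaf tT) a (leaf tF)
se (‵¬ P)    = replace (λ { tT → leaf tF ; tF → leaf tT }) (se P)
se (P ‵∧ Q)  = replace (λ { tT → se Q ; tF → leaf tF }) (se P)
se (P ‵∨ Q)  = replace (λ { tT → leaf tT ; tF → se Q }) (se P)

data Contains {L A : Set} (l : L) : Tree L A → Set where
  here  : Contains l (leaf l)
  left  : ∀ {X a Y} → Contains l X → Contains l (node X a Y)
  right : ∀ {X a Y} → Contains l Y → Contains l (node X a Y)

-- Write u ≼ t when t is obtained by grafting u onto every leaf of a skeleton. If
-- se(P) = X[△ ↦ Y] with X a proper skeleton, then Y ≼ both subtrees of the root.
-- Unfolding a *-term along its leftmost spine, se(P) is se(ℓ) for its leftmost
-- literal ℓ with T and F replaced by continuations u, v that have no common tail: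
-- this holds for the leaves T, F themselves and survives each unfolding step because
-- the skipped operand's se contains both T and F. The two root subtrees of se(ℓ) have
-- only T-leaves and only F-leaves respectively, so u and v are tails of the two root
-- subtrees of se(P). Tails of a common tree are comparable, hence u and v would share
-- the tail Y.
module Submission where

open import Data.Empty using (⊥-elim)
open import Data.Nat using (ℕ; suc; _+_; _≤_; _<_; s≤s)
open import Data.Nat.Properties using (≤-refl; ≤-trans; <⇒≤; <-≤-trans; <-irrefl; m≤m+n; m≤n+m; n≤1+n)
open import Data.Product using (Σ; _×_; _,_; proj₁; proj₂)
open import Data.Sum using (_⊎_; inj₁; inj₂)
open import Data.Unit using (⊤; tt)
open import Function using (_∘_)
open import Relation.Binary.PropositionalEquality using (_≡_; _≢_; refl; sym; trans; cong₂; subst)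
open import Relation.Nullary using (¬_)

open import Defs

private variable
  A L M N : Set

Skeleton : Set → Set
Skeleton = Tree ⊤

graft : Skeleton A → Tree M A → Tree M A
graft Z u = replace (λ _ → u) Z

erase : Tree L A → Skeleton A
erase = replace (λ _ → leaf tt)

size : Tree L A → ℕ
size (leaf _)     = 1
size (node l _ r) = suc (size l + size r)

node-injective : {l l′ r r′ : Tree L A} {a a′ : A} → node l a r ≡ node l′ a′ r′ → l ≡ l′ × r ≡ r′
node-injective refl = refl , refl

replace-leaf : (t : Tree L A) → replace leaf t ≡ t
replace-leaf (leaf _)     = refl
replace-leaf (node l a r) = cong₂ (λ x y → node x a y) (replace-leaf l) (replace-leaf r)

replace-replace : (κ : M → Tree N A) (σ : L → Tree M A) (t : Tree L A) →
                  replace κ (replace σ t) ≡ replace (replace κ ∘ σ) t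
replace-replace κ σ (leaf _)     = refl
replace-replace κ σ (node l a r) = cong₂ (λ x y → node x a y) (replace-replace κ σ l) (replace-replace κ σ r)

replace-uniform : {ρ : L → Tree M A} {u : Tree M A} (W : Tree L A) →
                  (∀ l → Contains l W → ρ l ≡ u) → replace ρ W ≡ graft (erase W) u
replace-uniform (leaf l)     ρ≡u = ρ≡u l here
replace-uniform (node l a r) ρ≡u = cong₂ (λ x y → node x a y)
  (replace-uniform l (λ k → ρ≡u k ∘ left)) (replace-uniform r (λ k → ρ≡u k ∘ right))

Contains-replace : {ρ : L → Tree M A} {l : L} {m : M} {W : Tree L A} →
                   Contains l W → Contains m (ρ l) → Contains m (replace ρ W)
Contains-replace here      m∈ρl = m∈ρl
Contains-replace (left c)  m∈ρl = left (Contains-replace c m∈ρl)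
Contains-replace (right c) m∈ρl = right (Contains-replace c m∈ρl)

size-replace-≤ : {ρ : L → Tree M A} {l : L} {W : Tree L A} → Contains l W → size (ρ l) ≤ size (replace ρ W)
size-replace-< : {ρ : L → Tree M A} {l : L} {W₁ W₂ : Tree L A} {b : A} →
                 Contains l (node W₁ b W₂) → size (ρ l) < size (replace ρ (node W₁ b W₂))
size-replace-≤ here        = ≤-refl
size-replace-≤ c@(left _)  = <⇒≤ (size-replace-< c)
size-replace-≤ c@(right _) = <⇒≤ (size-replace-< c)
size-replace-< (left c)  = s≤s (≤-trans (size-replace-≤ c) (m≤m+n _ _))
size-replace-< (right c) = s≤s (≤-trans (size-replace-≤ c) (m≤n+m _ _))

size-graft : (Z : Skeleton A) (u : Tree M A) → size u ≤ size (graft Z u)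
size-graft (leaf _)     u = ≤-refl
size-graft (node l _ r) u = ≤-trans (size-graft l u) (≤-trans (m≤m+n _ _) (n≤1+n _))

infix 4 _≼_

_≼_ : Tree M A → Tree M A → Set
_≼_ {A = A} u t = Σ (Skeleton A) λ Z → t ≡ graft Z u

Comparable : Tree M A → Tree M A → Set
Comparable u v = u ≼ v ⊎ v ≼ u

CommonTail : Tree M A → Tree M A → Set
CommonTail {M = M} {A = A} u v = Σ (Tree M A) λ Y → Y ≼ u × Y ≼ v

private variable
  t u v w Y : Tree M A

≼-refl : u ≼ u
≼-refl = leaf tt , refl

≼-trans : u ≼ v → v ≼ w → u ≼ w
≼-trans {u = u} (Z₁ , refl) (Z₂ , refl) = graft Z₂ Z₁ , sym (replace-replace (λ _ → u) (λ _ → Z₁) Z₂)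

≼-replace : (κ : M → Tree N A) → u ≼ t → replace κ u ≼ replace κ t
≼-replace {u = u} κ (Z , refl) = Z , replace-replace κ (λ _ → u) Z

≼-node : {a : A} → u ≼ t → u ≼ v → u ≼ node t a v
≼-node (Z₁ , refl) (Z₂ , refl) = node Z₁ _ Z₂ , refl

≼-size : u ≼ t → size u ≤ size t
≼-size {u = u} (Z , refl) = size-graft Z u

≼-Contains : {m : M} → u ≼ t → Contains m u → Contains m t
≼-Contains (leaf _     , refl) m∈u = m∈u
≼-Contains (node l _ _ , refl) m∈u = left (≼-Contains (l , refl) m∈u)

tails-comparable : u ≼ t → v ≼ t → Comparable u v
tails-comparable (leaf _ , refl) (Z , e) = inj₂ (Z , e)
tails-comparable (node l₁ b r₁ , e) (leaf _ , refl) = inj₁ (node l₁ b r₁ , e)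
tails-comparable (node l₁ _ _ , e₁) (node l₂ _ _ , e₂) =
  tails-comparable (l₁ , refl) (l₂ , proj₁ (node-injective (trans (sym e₁) e₂)))

common-tail : Comparable u Y → Comparable v Y → CommonTail u v
common-tail {Y = Y} (inj₂ Y≼u) (inj₂ Y≼v) = Y , Y≼u , Y≼v
common-tail {v = v} (inj₂ Y≼u) (inj₁ v≼Y) = v , ≼-trans v≼Y Y≼u , ≼-refl
common-tail {u = u} (inj₁ u≼Y) (inj₂ Y≼v) = u , ≼-refl , ≼-trans u≼Y Y≼v
common-tail {u = u} {v = v} (inj₁ u≼Y) (inj₁ v≼Y) with tails-comparable u≼Y v≼Y
... | inj₁ u≼v = u , ≼-refl , u≼v
... | inj₂ v≼u = v , v≼u , ≼-refl

CommonTail-sym : CommonTail u v → CommonTail v u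
CommonTail-sym (Y , Y≼u , Y≼v) = Y , Y≼v , Y≼u

leaves-no-CommonTail : ¬ CommonTail {A = A} (leaf tT) (leaf tF)
leaves-no-CommonTail (_ , (leaf _ , refl) , (leaf _ , ()))
leaves-no-CommonTail (_ , (leaf _ , refl) , (node _ _ _ , ()))
leaves-no-CommonTail (_ , (node _ _ _ , ()) , _)

NontrivialGraft : Tree M A → Set
NontrivialGraft {M = M} {A = A} t =
  Σ (Tree M A) λ Y → Σ (Skeleton A) λ Z₁ → Σ A λ b → Σ (Skeleton A) λ Z₂ → t ≡ graft (node Z₁ b Z₂) Y

node-not-NontrivialGraft : {l r : Tree M A} {a : A} → u ≼ l → v ≼ r → ¬ CommonTail u v →
                           ¬ NontrivialGraft (node l a r)
node-not-NontrivialGraft u≼l v≼r no-tail (Y , Z₁ , _ , Z₂ , e) =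
  no-tail (common-tail (tails-comparable u≼l (Z₁ , e₁)) (tails-comparable v≼r (Z₂ , e₂)))
  where
  e₁ = proj₁ (node-injective e)
  e₂ = proj₂ (node-injective e)

replace-node≢tail : {ρ : L → Tree M A} {l : L} {W₁ W₂ : Tree L A} {b : A} →
                    Y ≼ ρ l → Contains l (node W₁ b W₂) → replace ρ (node W₁ b W₂) ≢ Y
replace-node≢tail Y≼ρl l∈W refl = <-irrefl refl (<-≤-trans (size-replace-< l∈W) (≼-size Y≼ρl))

negate : LeafTF → LeafTF
negate tT = tF
negate tF = tT

Contains⊎≼-replace : (κ : LeafTF → Tree M A) (x : LeafTF) (W : TreeA A) →
                     Contains x W ⊎ κ (negate x) ≼ replace κ W
Contains⊎≼-replace κ tT (leaf tT) = inj₁ here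
Contains⊎≼-replace κ tT (leaf tF) = inj₂ ≼-refl
Contains⊎≼-replace κ tF (leaf tT) = inj₂ ≼-refl
Contains⊎≼-replace κ tF (leaf tF) = inj₁ here
Contains⊎≼-replace κ x (node W₁ _ W₂) with Contains⊎≼-replace κ x W₁ | Contains⊎≼-replace κ x W₂
... | inj₁ x∈W₁ | _         = inj₁ (left x∈W₁)
... | inj₂ _    | inj₁ x∈W₂ = inj₁ (right x∈W₂)
... | inj₂ ≼W₁  | inj₂ ≼W₂  = inj₂ (≼-node ≼W₁ ≼W₂)

-- Follow the path to an occurrence of negate x in W; the size argument excludes Y
-- being the image of a subtree of W that still contains x.
replace-tail-comparable : (κ : LeafTF → Tree M A) (x : LeafTF) (W : TreeA A) →
                          Y ≼ κ x → Y ≼ replace κ W → Contains (negate x) W → Comparable (κ (negate x)) Y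
replace-tail-comparable κ x (leaf _) _ Y≼W here = inj₂ Y≼W
replace-tail-comparable κ x W@(node _ _ _) Y≼κx (leaf _ , W≡Y) _ with Contains⊎≼-replace κ x W
... | inj₁ x∈W  = ⊥-elim (replace-node≢tail Y≼κx x∈W W≡Y)
... | inj₂ ≼W  = inj₁ (subst (κ (negate x) ≼_) W≡Y ≼W)
replace-tail-comparable κ x (node W₁ _ _) Y≼κx (node Z₁ _ _ , e) (left c) =
  replace-tail-comparable κ x W₁ Y≼κx (Z₁ , proj₁ (node-injective e)) c
replace-tail-comparable κ x (node _ _ W₂) Y≼κx (node _ _ Z₂ , e) (right c) =
  replace-tail-comparable κ x W₂ Y≼κx (Z₂ , proj₂ (node-injective e)) c

CommonTail-replace : (κ : LeafTF → Tree M A) (x : LeafTF) (W : TreeA A) → Contains (negate x) W →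
                     CommonTail (replace κ W) (κ x) → CommonTail (κ (negate x)) (κ x)
CommonTail-replace κ x W ¬x∈W (_ , Y≼W , Y≼κx) =
  common-tail (replace-tail-comparable κ x W Y≼κx Y≼W ¬x∈W) (inj₂ Y≼κx)

private variable
  P : Term A

PT-tail : IsPT P → leaf tT ≼ se P
PT-tail pT         = ≼-refl
PT-tail (pTst p q) = ≼-node (≼-replace _ (PT-tail p)) (PT-tail q)

PF-tail : IsPF P → leaf tF ≼ se P
PF-tail pF         = ≼-refl
PF-tail (pFst p q) = ≼-node (PF-tail q) (≼-replace _ (PF-tail p))

Lit-Contains : IsLit P → ∀ l → Contains l (se P)
Lit-Contains (pos p q) tT = left (≼-Contains (≼-replace _ (PT-tail p)) here)
Lit-Contains (pos p q) tF = right (≼-Contains (PF-tail q) here)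
Lit-Contains (neg p q) tT = right (≼-Contains (≼-replace _ (PT-tail p)) here)
Lit-Contains (neg p q) tF = left (≼-Contains (PF-tail q) here)

Star-Contains : IsStar P → ∀ l → Contains l (se P)
C-Contains    : IsC P → ∀ l → Contains l (se P)
D-Contains    : IsD P → ∀ l → Contains l (se P)
Star-Contains (starC c) = C-Contains c
Star-Contains (starD d) = D-Contains d
C-Contains (cLit ℓ)      = Lit-Contains ℓ
C-Contains (cAnd p q) tT = Contains-replace (Star-Contains p tT) (D-Contains q tT)
C-Contains (cAnd p q) tF = Contains-replace (Star-Contains p tF) here
D-Contains (dLit ℓ)      = Lit-Contains ℓ
D-Contains (dOr p q) tT  = Contains-replace (Star-Contains p tT) here
D-Contains (dOr p q) tF  = Contains-replace (Star-Contains p tF) (C-Contains q tF)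

Lit-not-NontrivialGraft : IsLit P → (κ : LeafTF → Tree M A) → ¬ CommonTail (κ tT) (κ tF) →
                          ¬ NontrivialGraft (replace κ (se P))
Lit-not-NontrivialGraft (pos p q) κ no-tail =
  node-not-NontrivialGraft (≼-replace κ (≼-replace _ (PT-tail p))) (≼-replace κ (PF-tail q)) no-tail
Lit-not-NontrivialGraft (neg p q) κ no-tail =
  node-not-NontrivialGraft (≼-replace κ (PF-tail q)) (≼-replace κ (≼-replace _ (PT-tail p)))
    (no-tail ∘ CommonTail-sym)

Star-not-NontrivialGraft : IsStar P → (κ : LeafTF → Tree M A) → ¬ CommonTail (κ tT) (κ tF) →
                           ¬ NontrivialGraft (replace κ (se P))
Star-not-NontrivialGraft (starC (cLit ℓ)) = Lit-not-NontrivialGraft ℓ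
Star-not-NontrivialGraft (starD (dLit ℓ)) = Lit-not-NontrivialGraft ℓ
Star-not-NontrivialGraft (starC (cAnd {P} {Q} p q)) κ no-tail g =
  Star-not-NontrivialGraft p _ (no-tail ∘ CommonTail-replace κ tF (se Q) (D-Contains q tT))
    (subst NontrivialGraft (replace-replace κ _ (se P)) g)
Star-not-NontrivialGraft (starD (dOr {P} {Q} p q)) κ no-tail g =
  Star-not-NontrivialGraft p _ (no-tail ∘ CommonTail-sym ∘ CommonTail-replace κ tT (se Q) (C-Contains q tF) ∘ CommonTail-sym)
    (subst NontrivialGraft (replace-replace κ _ (se P)) g)

subst△-NontrivialGraft : {X : TreeΔ A} {Y : TreeA A} →
                         X ≢ leaf l△ → ¬ Contains lT X → ¬ Contains lF X → NontrivialGraft (subst△ X Y)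
subst△-NontrivialGraft {X = leaf lT} _ noT _ = ⊥-elim (noT here)
subst△-NontrivialGraft {X = leaf lF} _ _ noF = ⊥-elim (noF here)
subst△-NontrivialGraft {X = leaf l△} X≢△ _ _ = ⊥-elim (X≢△ refl)
subst△-NontrivialGraft {X = X@(node X₁ b X₂)} {Y} _ noT noF =
  Y , erase X₁ , b , erase X₂ ,
  replace-uniform X λ { lT c → ⊥-elim (noT c) ; lF c → ⊥-elim (noF c) ; l△ _ → refl }

lemma3p3 : {A : Set} → A → ¬ (Σ (Term A) λ P → IsStar P × Σ (TreeΔ A) λ X → Σ (TreeA A) λ Y → (se P ≡ subst△ X Y) × (X ≢ leaf l△) × Contains l△ X × ¬ Contains lT X × ¬ Contains lF X)
lemma3p3 _ (P , star , X , Y , se≡ , X≢△ , _ , noT , noF) =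
  Star-not-NontrivialGraft star leaf leaves-no-CommonTail
    (subst NontrivialGraft (sym (trans (replace-leaf (se P)) se≡)) (subst△-NontrivialGraft X≢△ noT noF))
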